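{- Let $n\geq 1$. Let $\mathcal{Q}_n$ be the set of generalized partitions of $n$ with greatest common divisor $1$, and let $\overline{K}_n^{\geq 0}$ be the set of equivalence classes, under $\approx$, of irreducible square matrices (of any size) with entries in $\mathbb{Z}_{\geq 0}$ satisfying $A^2=nA$. Then the map $\varphi:\mathcal{Q}_n\to\overline{K}_n^{\geq 0}$ sending the generalized partition $\{(v_1,w_1),\dots,(v_k,w_k)\}$ to the class of the matrix $vw^t$, where $v=(v_1,\dots,v_k)^t$ and $w=(w_1,\dots,w_k)^t$, is a (well-defined) bijection.
   Context: A generalized partition of $n$ is a finite nonempty multiset $\{(v_1,w_1),\dots,(v_k,w_k)\}$ of pairs of positive integers with $\sum_{i=1}^k v_iw_i=n$ (equivalently, a generalized composition $v_1^{w_1}\cdots v_k^{w_k}$ of $n$ considered up to reordering of its $k$ pairs). Its greatest common divisor is $\gcd(v_1,\dots,v_k)$. A non-negative $k\times k$ matrix $A$ is irreducible if for every pair $i,j$ there exists $m\geq 1$ with $(A^m)_{i,j}>0$. For $k\times k$ matrices $A,B$, write $A\approx B$ if there is a permutation $\sigma\in S_k$ with $P_\sigma^{ -1}AP_\sigma=B$, where $P_\sigma$ is the permutation matrix with $P_\sigma e_i=e_{\sigma(i)}$. -}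

module Defs where

open import Data.Nat using (ℕ; zero; suc; _+_; _*_; _≤_; _<_)
open import Data.Nat.GCD using (gcd)
open import Data.Fin using (Fin; zero; suc)
open import Data.Fin.Permutation using (Permutation; _⟨$⟩ʳ_)
open import Data.Product using (Σ; ∃; _×_)
open import Relation.Binary.PropositionalEquality using (_≡_)

∑ : ∀ {k} → (Fin k → ℕ) → ℕ
∑ {zero}  f = 0
∑ {suc k} f = f zero + ∑ (λ i → f (suc i))

gcdFin : ∀ {k} → (Fin k → ℕ) → ℕ
gcdFin {zero}  f = 0
gcdFin {suc k} f = gcd (f zero) (gcdFin (λ i → f (suc i)))

Mat : ℕ → Set
Mat k = Fin k → Fin k → ℕ

_⊗_ : ∀ {k} → Mat k → Mat k → Mat k
(A ⊗ B) i j = ∑ (λ l → A i l * B l j)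

idMat : ∀ {k} → Mat k
idMat {suc k} zero    zero    = 1
idMat {suc k} zero    (suc j) = 0
idMat {suc k} (suc i) zero    = 0
idMat {suc k} (suc i) (suc j) = idMat {k} i j

matPow : ∀ {k} → Mat k → ℕ → Mat k
matPow A zero    = idMat
matPow A (suc m) = A ⊗ matPow A m

Irreducible : ∀ {k} → Mat k → Set
Irreducible {k} A = ∀ (i j : Fin k) → ∃ λ m → 1 ≤ m × 0 < matPow A m i j

record SqMat : Set where
  constructor sqMat
  field
    size    : ℕ
    size≥1  : 1 ≤ size
    entry   : Mat size
open SqMat public

InK : ℕ → SqMat → Set
InK n M = Irreducible (entry M)
        × (∀ i j → (entry M ⊗ entry M) i j ≡ n * entry M i j)

-- A ≈ B : ∃ σ with P_σ⁻¹ A P_σ = B, i.e. B_{ij} = A_{σ(i) σ(j)}.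
_≈M_ : SqMat → SqMat → Set
A ≈M B = Σ (Permutation (size B) (size A)) λ σ →
           ∀ i j → entry B i j ≡ entry A (σ ⟨$⟩ʳ i) (σ ⟨$⟩ʳ j)

-- Generalized partitions of n, as indexed families of k ≥ 1 pairs
-- (v_i, w_i) of positive integers with ∑ v_i w_i = n; they are identified
-- up to reordering of the pairs (the relation _~P_ below), which gives
-- exactly the finite nonempty multisets of pairs.

record GenPartition (n : ℕ) : Set where
  constructor genPartition
  field
    len    : ℕ
    len≥1  : 1 ≤ len
    v      : Fin len → ℕ
    w      : Fin len → ℕ
    v-pos  : ∀ i → 1 ≤ v i
    w-pos  : ∀ i → 1 ≤ w i
    total  : ∑ (λ i → v i * w i) ≡ n
open GenPartition public

_~P_ : ∀ {n} → GenPartition n → GenPartition n → Set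
p ~P q = Σ (Permutation (len q) (len p)) λ σ →
           ∀ i → (v q i ≡ v p (σ ⟨$⟩ʳ i)) × (w q i ≡ w p (σ ⟨$⟩ʳ i))

gcdGP : ∀ {n} → GenPartition n → ℕ
gcdGP p = gcdFin (v p)

φ : ∀ {n} → GenPartition n → SqMat
φ p = sqMat (len p) (len≥1 p) (λ i j → v p i * w p j)

-- A matrix v wᵗ with positive entries is irreducible and satisfies
-- (v wᵗ)² = (∑ vᵢ wᵢ) · v wᵗ; the only freedom in writing a rank-one matrix as
-- v wᵗ is v ↦ c v, w ↦ w / c, and gcd v = 1 removes it.  Conversely, if A ≥ 0 is
-- irreducible with A² = nA, then Aᵐ⁺¹ = nᵐ A, so every entry of A is positive.
-- For two rows i, r choose a column j₀ minimising A i j / A r j: the entries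
-- (i, j₀) and (r, j₀) of A² = nA force all these ratios to be equal, so A has
-- rank one, and dividing its first column by its gcd yields the partition.

module Submission where

open import Defs
open import Data.Nat.Properties
open import Algebra.Properties.CommutativeSemigroup *-commutativeSemigroup
  using (x∙yz≈y∙xz; x∙yz≈yx∙z; x∙yz≈z∙yx; xy∙z≈y∙xz; xy∙z≈x∙zy)
open import Data.Nat using (ℕ; zero; suc; _+_; _*_; _^_; _≤_; _<_; z≤n; z<s; >-nonZero)
open import Data.Nat.Divisibility using (_∣_; divides; ∣-antisym; ∣-trans)
open import Data.Nat.GCD using (gcd; gcd-greatest; gcd[m,n]∣m; gcd[m,n]∣n; c*gcd[m,n]≡gcd[cm,cn])
open import Data.Nat.Tactic.RingSolver using (solve-∀)
open import Data.Fin using (Fin; zero; suc)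
open import Data.Fin.Permutation using (Permutation; _⟨$⟩ʳ_; _⟨$⟩ˡ_; inverseʳ; id)
open import Data.Product using (Σ; ∃; _×_; _,_; proj₁; proj₂)
open import Data.Sum using (_⊎_; inj₁; inj₂; reduce)
open import Data.Vec.Functional using (tail)
open import Relation.Binary.PropositionalEquality

*-swap-inner : ∀ a b c d → a * b * (c * d) ≡ a * d * (c * b)
*-swap-inner = solve-∀

*-swap-outer : ∀ a b c d → a * b * (c * d) ≡ c * b * (a * d)
*-swap-outer = solve-∀

m*n>0⇒m>0 : ∀ m n → 0 < m * n → 0 < m
m*n>0⇒m>0 (suc m) n _ = z<s

m*n>0⇒n>0 : ∀ m n → 0 < m * n → 0 < n
m*n>0⇒n>0 m n mn>0 = m*n>0⇒m>0 n m (subst (0 <_) (*-comm m n) mn>0)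

∑-cong : ∀ {k} {f g : Fin k → ℕ} → (∀ i → f i ≡ g i) → ∑ f ≡ ∑ g
∑-cong {zero}  f≗g = refl
∑-cong {suc k} f≗g = cong₂ _+_ (f≗g zero) (∑-cong (λ i → f≗g (suc i)))

∑-zero : ∀ k → ∑ {k} (λ _ → 0) ≡ 0
∑-zero zero    = refl
∑-zero (suc k) = ∑-zero k

∑-distribˡ : ∀ {k} c (f : Fin k → ℕ) → ∑ (λ i → c * f i) ≡ c * ∑ f
∑-distribˡ {zero}  c f = sym (*-zeroʳ c)
∑-distribˡ {suc k} c f =
  trans (cong (c * f zero +_) (∑-distribˡ c (tail f))) (sym (*-distribˡ-+ c (f zero) _))

∑-mono-≤ : ∀ {k} {f g : Fin k → ℕ} → (∀ i → f i ≤ g i) → ∑ f ≤ ∑ g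
∑-mono-≤ {zero}  f≤g = z≤n
∑-mono-≤ {suc k} f≤g = +-mono-≤ (f≤g zero) (∑-mono-≤ (λ i → f≤g (suc i)))

≤∧∑≡⇒≡ : ∀ {k} {f g : Fin k → ℕ} → (∀ i → f i ≤ g i) → ∑ f ≡ ∑ g → ∀ i → f i ≡ g i
≤∧∑≡⇒≡ {suc k} {f} {g} f≤g ∑f≡∑g zero    = head≡
  where
  head≡ : f zero ≡ g zero
  head≡ = ≤-antisym (f≤g zero) (+-cancelʳ-≤ (∑ (tail f)) (g zero) (f zero)
    (≤-trans (+-monoʳ-≤ (g zero) (∑-mono-≤ (λ i → f≤g (suc i)))) (≤-reflexive (sym ∑f≡∑g))))
≤∧∑≡⇒≡ {suc k} {f} {g} f≤g ∑f≡∑g (suc i) = ≤∧∑≡⇒≡ (λ i → f≤g (suc i)) ∑tail≡ i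
  where
  ∑tail≡ : ∑ (tail f) ≡ ∑ (tail g)
  ∑tail≡ = +-cancelˡ-≡ (f zero) _ _
    (trans ∑f≡∑g (cong (_+ ∑ (tail g)) (sym (≤∧∑≡⇒≡ f≤g ∑f≡∑g zero))))

gcdFin-cong : ∀ {k} {f g : Fin k → ℕ} → (∀ i → f i ≡ g i) → gcdFin f ≡ gcdFin g
gcdFin-cong {zero}  f≗g = refl
gcdFin-cong {suc k} f≗g = cong₂ gcd (f≗g zero) (gcdFin-cong (λ i → f≗g (suc i)))

gcdFin-∣ : ∀ {k} (f : Fin k → ℕ) i → gcdFin f ∣ f i
gcdFin-∣ {suc k} f zero    = gcd[m,n]∣m (f zero) (gcdFin (tail f))
gcdFin-∣ {suc k} f (suc i) = ∣-trans (gcd[m,n]∣n (f zero) (gcdFin (tail f))) (gcdFin-∣ (tail f) i)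

gcdFin-greatest : ∀ {k d} {f : Fin k → ℕ} → (∀ i → d ∣ f i) → d ∣ gcdFin f
gcdFin-greatest {zero}  d∣f = divides 0 refl
gcdFin-greatest {suc k} d∣f = gcd-greatest (d∣f zero) (gcdFin-greatest (λ i → d∣f (suc i)))

c*gcdFin≡gcdFin[c*] : ∀ {k} c (f : Fin k → ℕ) → c * gcdFin f ≡ gcdFin (λ i → c * f i)
c*gcdFin≡gcdFin[c*] {zero}  c f = *-zeroʳ c
c*gcdFin≡gcdFin[c*] {suc k} c f =
  trans (c*gcd[m,n]≡gcd[cm,cn] c (f zero) _) (cong (gcd (c * f zero)) (c*gcdFin≡gcdFin[c*] c (tail f)))

∣-*gcdFin : ∀ {k d} c (f : Fin k → ℕ) → (∀ i → d ∣ c * f i) → d ∣ c * gcdFin f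
∣-*gcdFin c f d∣cf = subst (_ ∣_) (sym (c*gcdFin≡gcdFin[c*] c f)) (gcdFin-greatest d∣cf)

∣-by-coprime-family : ∀ {k d c} {f : Fin k → ℕ} → gcdFin f ≡ 1 → (∀ i → d ∣ c * f i) → d ∣ c
∣-by-coprime-family {c = c} {f} gcd≡1 d∣cf =
  subst (_ ∣_) (trans (cong (c *_) gcd≡1) (*-identityʳ c)) (∣-*gcdFin c f d∣cf)

gcdFin-∘-permutation : ∀ {k m} (σ : Permutation k m) (f : Fin m → ℕ) →
                       gcdFin (λ i → f (σ ⟨$⟩ʳ i)) ≡ gcdFin f
gcdFin-∘-permutation {k} σ f = ∣-antisym
  (gcdFin-greatest λ j → subst (gcdFin f∘σ ∣_) (cong f (inverseʳ σ)) (gcdFin-∣ f∘σ (σ ⟨$⟩ˡ j)))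
  (gcdFin-greatest λ i → gcdFin-∣ f (σ ⟨$⟩ʳ i))
  where
  f∘σ : Fin k → ℕ
  f∘σ i = f (σ ⟨$⟩ʳ i)

gcdFin-pos : ∀ {k} (f : Fin k → ℕ) i → 0 < f i → 0 < gcdFin f
gcdFin-pos f i fᵢ>0 with gcdFin-∣ f i
... | divides q fᵢ≡q*g = m*n>0⇒n>0 q _ (subst (0 <_) fᵢ≡q*g fᵢ>0)

primitive-part : ∀ {k} (f : Fin k → ℕ) → 0 < gcdFin f →
                 ∃ λ q → gcdFin q ≡ 1 × (∀ i → f i ≡ q i * gcdFin f)
primitive-part {k} f g>0 = q , gcd[q]≡1 , f≡q*g
  where
  q : Fin k → ℕ
  q i = _∣_.quotient (gcdFin-∣ f i)
  f≡q*g : ∀ i → f i ≡ q i * gcdFin f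
  f≡q*g i = _∣_.equality (gcdFin-∣ f i)
  gcd[q]≡1 : gcdFin q ≡ 1
  gcd[q]≡1 = *-cancelˡ-≡ (gcdFin q) 1 (gcdFin f) {{>-nonZero g>0}} (begin
    gcdFin f * gcdFin q              ≡⟨ c*gcdFin≡gcdFin[c*] (gcdFin f) q ⟩
    gcdFin (λ i → gcdFin f * q i)    ≡⟨ gcdFin-cong (λ i → trans (*-comm (gcdFin f) (q i)) (sym (f≡q*g i))) ⟩
    gcdFin f                         ≡⟨ sym (*-identityʳ (gcdFin f)) ⟩
    gcdFin f * 1                     ∎)
    where open ≡-Reasoning

outer : ∀ {k} → (Fin k → ℕ) → (Fin k → ℕ) → Mat k
outer u w i j = u i * w j

outer-square : ∀ {k} (u w : Fin k → ℕ) i j →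
               (outer u w ⊗ outer u w) i j ≡ ∑ (λ l → u l * w l) * outer u w i j
outer-square u w i j = begin
  ∑ (λ l → u i * w l * (u l * w j))    ≡⟨ ∑-cong (λ l → *-swap-inner (u i) (w l) (u l) (w j)) ⟩
  ∑ (λ l → u i * w j * (u l * w l))    ≡⟨ ∑-distribˡ (u i * w j) (λ l → u l * w l) ⟩
  u i * w j * ∑ (λ l → u l * w l)      ≡⟨ *-comm (u i * w j) _ ⟩
  ∑ (λ l → u l * w l) * (u i * w j)    ∎
  where open ≡-Reasoning

proportional⇒≡ : ∀ {k} {u u′ : Fin k → ℕ} → gcdFin u ≡ 1 → gcdFin u′ ≡ 1 →
                 (∀ i j → u i * u′ j ≡ u′ i * u j) → ∀ i → u i ≡ u′ i
proportional⇒≡ {u = u} {u′} gcd[u]≡1 gcd[u′]≡1 prop i = ∣-antisym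
  (∣-by-coprime-family gcd[u]≡1 λ j → divides (u′ j) (trans (sym (prop i j)) (*-comm (u i) (u′ j))))
  (∣-by-coprime-family gcd[u′]≡1 λ j → divides (u j) (trans (prop i j) (*-comm (u′ i) (u j))))

outer-injective : ∀ {k} {u w u′ w′ : Fin k → ℕ} → gcdFin u ≡ 1 → gcdFin u′ ≡ 1 →
                  (∀ i → 0 < u i) → (∀ j → 0 < w′ j) →
                  (∀ i j → outer u w i j ≡ outer u′ w′ i j) → ∀ i → u i ≡ u′ i × w i ≡ w′ i
outer-injective {u = u} {w} {u′} {w′} gcd[u]≡1 gcd[u′]≡1 u>0 w′>0 uw≡u′w′ i = u≡u′ i , w≡w′
  where
  proportional : ∀ i j → u i * u′ j ≡ u′ i * u j
  proportional i j = *-cancelʳ-≡ _ _ (w′ i) {{>-nonZero (w′>0 i)}} (begin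
    u i * u′ j * w′ i      ≡⟨ *-assoc (u i) (u′ j) (w′ i) ⟩
    u i * (u′ j * w′ i)    ≡⟨ cong (u i *_) (sym (uw≡u′w′ j i)) ⟩
    u i * (u j * w i)      ≡⟨ x∙yz≈y∙xz (u i) (u j) (w i) ⟩
    u j * (u i * w i)      ≡⟨ cong (u j *_) (uw≡u′w′ i i) ⟩
    u j * (u′ i * w′ i)    ≡⟨ x∙yz≈yx∙z (u j) (u′ i) (w′ i) ⟩
    u′ i * u j * w′ i      ∎)
    where open ≡-Reasoning
  u≡u′ : ∀ i → u i ≡ u′ i
  u≡u′ = proportional⇒≡ gcd[u]≡1 gcd[u′]≡1 proportional
  w≡w′ : w i ≡ w′ i
  w≡w′ = *-cancelˡ-≡ (w i) (w′ i) (u i) {{>-nonZero (u>0 i)}}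
    (trans (uw≡u′w′ i i) (cong (_* w′ i) (sym (u≡u′ i))))

Positive : ∀ {k} → Mat k → Set
Positive A = ∀ i j → 0 < A i j

QuasiIdempotent : ∀ {k} → ℕ → Mat k → Set
QuasiIdempotent n A = ∀ i j → (A ⊗ A) i j ≡ n * A i j

∑-*-idMat : ∀ {k} (f : Fin k → ℕ) j → ∑ (λ l → f l * idMat l j) ≡ f j
∑-*-idMat {suc k} f zero = begin
  f zero * 1 + ∑ (λ l → f (suc l) * 0)   ≡⟨ cong₂ _+_ (*-identityʳ (f zero)) (∑-cong (λ l → *-zeroʳ (f (suc l)))) ⟩
  f zero + ∑ {k} (λ _ → 0)              ≡⟨ cong (f zero +_) (∑-zero k) ⟩
  f zero + 0                            ≡⟨ +-identityʳ (f zero) ⟩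
  f zero                                ∎
  where open ≡-Reasoning
∑-*-idMat {suc k} f (suc j) =
  trans (cong (_+ ∑ (λ l → f (suc l) * idMat l j)) (*-zeroʳ (f zero))) (∑-*-idMat (tail f) j)

positive⇒irreducible : ∀ {k} {A : Mat k} → Positive A → Irreducible A
positive⇒irreducible {A = A} A>0 i j = 1 , ≤-refl , subst (0 <_) (sym (∑-*-idMat (A i) j)) (A>0 i j)

matPow-suc : ∀ {k n} {A : Mat k} → QuasiIdempotent n A → ∀ m i j → matPow A (suc m) i j ≡ n ^ m * A i j
matPow-suc {A = A} A²≡nA zero i j = trans (∑-*-idMat (A i) j) (sym (*-identityˡ (A i j)))
matPow-suc {n = n} {A} A²≡nA (suc m) i j = begin
  ∑ (λ l → A i l * matPow A (suc m) l j)  ≡⟨ ∑-cong (λ l → cong (A i l *_) (matPow-suc A²≡nA m l j)) ⟩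
  ∑ (λ l → A i l * (n ^ m * A l j))       ≡⟨ ∑-cong (λ l → x∙yz≈y∙xz (A i l) (n ^ m) (A l j)) ⟩
  ∑ (λ l → n ^ m * (A i l * A l j))       ≡⟨ ∑-distribˡ (n ^ m) (λ l → A i l * A l j) ⟩
  n ^ m * (A ⊗ A) i j                     ≡⟨ cong (n ^ m *_) (A²≡nA i j) ⟩
  n ^ m * (n * A i j)                     ≡⟨ x∙yz≈yx∙z (n ^ m) n (A i j) ⟩
  n ^ suc m * A i j                       ∎
  where open ≡-Reasoning

irreducible⇒positive : ∀ {k n} {A : Mat k} → QuasiIdempotent n A → Irreducible A → Positive A
irreducible⇒positive {n = n} {A} A²≡nA irr i j with irr i j
... | suc m , _ , Aᵐ⁺¹>0 = m*n>0⇒n>0 (n ^ m) (A i j) (subst (0 <_) (matPow-suc A²≡nA m i j) Aᵐ⁺¹>0)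

least-element : ∀ {k} (R : Fin (suc k) → Fin (suc k) → Set) →
                (∀ x y → R x y ⊎ R y x) → (∀ {x y z} → R x y → R y z → R x z) →
                ∃ λ x → ∀ y → R x y
least-element {zero} R R-total R-trans = zero , λ { zero → reduce (R-total zero zero) }
least-element {suc k} R R-total R-trans
  with least-element (λ x y → R (suc x) (suc y)) (λ x y → R-total (suc x) (suc y)) R-trans
... | m , m≤ with R-total zero (suc m)
...   | inj₁ 0≤m = zero  , λ { zero → reduce (R-total zero zero) ; (suc y) → R-trans 0≤m (m≤ y) }
...   | inj₂ m≤0 = suc m , λ { zero → m≤0 ; (suc y) → m≤ y }

-- a x * b y ≤ a y * b x says a x / b x ≤ a y / b y.
ratio-≤-trans : ∀ {k} {a b : Fin k → ℕ} {x y z} → 0 < a y → 0 < b y →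
                a x * b y ≤ a y * b x → a y * b z ≤ a z * b y → a x * b z ≤ a z * b x
ratio-≤-trans {a = a} {b} {x} {y} {z} aᵧ>0 bᵧ>0 x≼y y≼z =
  *-cancelʳ-≤ _ _ (a y * b y) {{>-nonZero (*-mono-≤ aᵧ>0 bᵧ>0)}} (begin
    a x * b z * (a y * b y)  ≡⟨ *-swap-inner (a x) (b z) (a y) (b y) ⟩
    a x * b y * (a y * b z)  ≤⟨ *-mono-≤ x≼y y≼z ⟩
    a y * b x * (a z * b y)  ≡⟨ *-swap-outer (a y) (b x) (a z) (b y) ⟩
    a z * b x * (a y * b y)  ∎)
  where open ≤-Reasoning

minimal-ratio : ∀ {k} {a b : Fin (suc k) → ℕ} → (∀ j → 0 < a j) → (∀ j → 0 < b j) →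
                ∃ λ j₀ → ∀ j → a j₀ * b j ≤ a j * b j₀
minimal-ratio {a = a} {b} a>0 b>0 = least-element (λ x y → a x * b y ≤ a y * b x)
  (λ x y → ≤-total (a x * b y) (a y * b x)) (λ {_} {y} → ratio-≤-trans {a = a} {b} (a>0 y) (b>0 y))

pivot⇒minors-vanish : ∀ {k} {a b : Fin k → ℕ} {j₀} → 0 < a j₀ → 0 < b j₀ →
                      (∀ l → a j₀ * b l ≡ a l * b j₀) → ∀ j l → a j * b l ≡ a l * b j
pivot⇒minors-vanish {a = a} {b} {j₀} a₀>0 b₀>0 pivot j l =
  *-cancelʳ-≡ _ _ (a j₀ * b j₀) {{>-nonZero (*-mono-≤ a₀>0 b₀>0)}} (begin
    a j * b l * (a j₀ * b j₀)    ≡⟨ *-swap-outer (a j) (b l) (a j₀) (b j₀) ⟩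
    a j₀ * b l * (a j * b j₀)    ≡⟨ cong₂ _*_ (pivot l) (sym (pivot j)) ⟩
    a l * b j₀ * (a j₀ * b j)    ≡⟨ *-swap-inner (a l) (b j₀) (a j₀) (b j) ⟩
    a l * b j * (a j₀ * b j₀)    ∎)
  where open ≡-Reasoning

-- Take j₀ minimising A i j / A r j.  Weighted by column j₀, both sides of the
-- resulting termwise inequality sum to n · A i j₀ · A r j₀, so it is an equality.
proportional-rows : ∀ {k n} {A : Mat (suc k)} → Positive A → QuasiIdempotent n A →
                    ∀ i r → ∃ λ j₀ → ∀ l → A i j₀ * A r l ≡ A i l * A r j₀
proportional-rows {k} {n} {A} A>0 A²≡nA i r with minimal-ratio (A>0 i) (A>0 r)
... | j₀ , minimal = j₀ , λ l →
  *-cancelʳ-≡ (A i j₀ * A r l) (A i l * A r j₀) (A l j₀) {{>-nonZero (A>0 l j₀)}} (≤∧∑≡⇒≡ f≤g ∑f≡∑g l)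
  where
  f g : Fin (suc k) → ℕ
  f l = A i j₀ * A r l * A l j₀
  g l = A i l * A r j₀ * A l j₀
  f≤g : ∀ l → f l ≤ g l
  f≤g l = *-monoˡ-≤ (A l j₀) (minimal l)
  column-sum : ∀ c x → ∑ (λ l → c * (A x l * A l j₀)) ≡ c * (n * A x j₀)
  column-sum c x = trans (∑-distribˡ c (λ l → A x l * A l j₀)) (cong (c *_) (A²≡nA x j₀))
  ∑f≡∑g : ∑ f ≡ ∑ g
  ∑f≡∑g = begin
    ∑ f                                  ≡⟨ ∑-cong (λ l → *-assoc (A i j₀) (A r l) (A l j₀)) ⟩
    ∑ (λ l → A i j₀ * (A r l * A l j₀))  ≡⟨ column-sum (A i j₀) r ⟩
    A i j₀ * (n * A r j₀)                ≡⟨ x∙yz≈z∙yx (A i j₀) n (A r j₀) ⟩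
    A r j₀ * (n * A i j₀)                ≡⟨ column-sum (A r j₀) i ⟨
    ∑ (λ l → A r j₀ * (A i l * A l j₀))  ≡⟨ ∑-cong (λ l → xy∙z≈y∙xz (A i l) (A r j₀) (A l j₀)) ⟨
    ∑ g                                  ∎
    where open ≡-Reasoning

minors-vanish : ∀ {k n} {A : Mat (suc k)} → Positive A → QuasiIdempotent n A →
                ∀ i r j l → A i j * A r l ≡ A i l * A r j
minors-vanish {n = n} {A} A>0 A²≡nA i r =
  let j₀ , pivot = proportional-rows {n = n} A>0 A²≡nA i r
  in pivot⇒minors-vanish {a = A i} {A r} (A>0 i j₀) (A>0 r j₀) pivot

record PrimitiveFactorisation {k} (A : Mat k) : Set where
  field
    col row     : Fin k → ℕ
    col-pos     : ∀ i → 0 < col i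
    row-pos     : ∀ j → 0 < row j
    col-coprime : gcdFin col ≡ 1
    factorises  : ∀ i j → A i j ≡ outer col row i j

-- col is column 0 divided by its gcd g; the vanishing minors make A 0 0 divide
-- A 0 j · g, and row j is the quotient.
primitive-factorisation : ∀ {k} {A : Mat (suc k)} → Positive A →
                          (∀ i r j l → A i j * A r l ≡ A i l * A r j) → PrimitiveFactorisation A
primitive-factorisation {k} {A} A>0 minors = record
  { col = col ; row = row ; col-pos = col-pos ; row-pos = row-pos
  ; col-coprime = col-coprime ; factorises = factorises }
  where
  column : Fin (suc k) → ℕ
  column i = A i zero
  g : ℕ
  g = gcdFin column
  reduced : ∃ λ q → gcdFin q ≡ 1 × (∀ i → column i ≡ q i * g)
  reduced = primitive-part column (gcdFin-pos column zero (A>0 zero zero))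
  col : Fin (suc k) → ℕ
  col = proj₁ reduced
  col-coprime : gcdFin col ≡ 1
  col-coprime = proj₁ (proj₂ reduced)
  Aᵢ₀≡col*g : ∀ i → A i zero ≡ col i * g
  Aᵢ₀≡col*g = proj₂ (proj₂ reduced)
  A₀₀∣A₀ⱼ*g : ∀ j → A zero zero ∣ A zero j * g
  A₀₀∣A₀ⱼ*g j = ∣-*gcdFin (A zero j) column λ l →
    divides (A l j) (trans (*-comm (A zero j) (A l zero)) (sym (minors l zero j zero)))
  row : Fin (suc k) → ℕ
  row j = _∣_.quotient (A₀₀∣A₀ⱼ*g j)
  factorises : ∀ i j → A i j ≡ col i * row j
  factorises i j =
    *-cancelʳ-≡ (A i j) (col i * row j) (A zero zero) {{>-nonZero (A>0 zero zero)}} (begin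
    A i j * A zero zero            ≡⟨ minors i zero j zero ⟩
    A i zero * A zero j            ≡⟨ cong (_* A zero j) (Aᵢ₀≡col*g i) ⟩
    col i * g * A zero j           ≡⟨ xy∙z≈x∙zy (col i) g (A zero j) ⟩
    col i * (A zero j * g)         ≡⟨ cong (col i *_) (_∣_.equality (A₀₀∣A₀ⱼ*g j)) ⟩
    col i * (row j * A zero zero)  ≡⟨ *-assoc (col i) (row j) (A zero zero) ⟨
    col i * row j * A zero zero    ∎)
    where open ≡-Reasoning
  col-pos : ∀ i → 0 < col i
  col-pos i = m*n>0⇒m>0 (col i) g (subst (0 <_) (Aᵢ₀≡col*g i) (A>0 i zero))
  row-pos : ∀ j → 0 < row j
  row-pos j = m*n>0⇒n>0 (col zero) (row j) (subst (0 <_) (factorises zero j) (A>0 zero j))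

factorisation-total : ∀ {k n} {A : Mat (suc k)} → QuasiIdempotent n A →
                      (F : PrimitiveFactorisation A) →
                      let open PrimitiveFactorisation F in ∑ (λ l → col l * row l) ≡ n
factorisation-total {n = n} {A} A²≡nA F = *-cancelʳ-≡ (∑ (λ l → col l * row l)) n (col zero * row zero)
  {{>-nonZero (*-mono-≤ (col-pos zero) (row-pos zero))}} (begin
    ∑ (λ l → col l * row l) * (col zero * row zero)  ≡⟨ outer-square col row zero zero ⟨
    (outer col row ⊗ outer col row) zero zero        ≡⟨ ∑-cong (λ l → cong₂ _*_ (factorises zero l) (factorises l zero)) ⟨
    (A ⊗ A) zero zero                                ≡⟨ A²≡nA zero zero ⟩
    n * A zero zero                                  ≡⟨ cong (n *_) (factorises zero zero) ⟩
    n * (col zero * row zero)                        ∎)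
  where
  open PrimitiveFactorisation F
  open ≡-Reasoning

φ-InK : ∀ {n} (p : GenPartition n) → InK n (φ p)
φ-InK p = positive⇒irreducible (λ i j → *-mono-≤ (v-pos p i) (w-pos p j))
        , λ i j → trans (outer-square (v p) (w p) i j) (cong (_* _) (total p))

φ-cong : ∀ {n} (p q : GenPartition n) → p ~P q → φ p ≈M φ q
φ-cong p q (σ , same) = σ , λ i j → cong₂ _*_ (proj₁ (same i)) (proj₂ (same j))

φ-injective : ∀ {n} (p q : GenPartition n) → gcdGP p ≡ 1 → gcdGP q ≡ 1 → φ p ≈M φ q → p ~P q
φ-injective p q gcd[p]≡1 gcd[q]≡1 (σ , φq≡φp∘σ) =
  σ , outer-injective {u = v q} {w q} {λ i → v p (σ ⟨$⟩ʳ i)} {λ j → w p (σ ⟨$⟩ʳ j)} gcd[q]≡1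
  (trans (gcdFin-∘-permutation σ (v p)) gcd[p]≡1) (v-pos q) (λ j → w-pos p (σ ⟨$⟩ʳ j)) φq≡φp∘σ

φ-surjective : ∀ n (M : SqMat) → InK n M → Σ (GenPartition n) λ p → gcdGP p ≡ 1 × φ p ≈M M
φ-surjective n (sqMat (suc k) size≥1 A) (irr , A²≡nA) = partition , col-coprime , id , factorises
  where
  A>0 : Positive A
  A>0 = irreducible⇒positive {n = n} A²≡nA irr
  F : PrimitiveFactorisation A
  F = primitive-factorisation A>0 (minors-vanish {n = n} A>0 A²≡nA)
  open PrimitiveFactorisation F
  partition : GenPartition n
  partition = genPartition (suc k) size≥1 col row col-pos row-pos (factorisation-total A²≡nA F)

lemma4p3 : (n : ℕ) → 1 ≤ n →
    -- φ maps Q_n into K̄ⁿ≥0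
    ((p : GenPartition n) → gcdGP p ≡ 1 → InK n (φ p))
    -- well-defined on multisets
    × ((p q : GenPartition n) → gcdGP p ≡ 1 → gcdGP q ≡ 1 → p ~P q → φ p ≈M φ q)
    -- injective on classes
    × ((p q : GenPartition n) → gcdGP p ≡ 1 → gcdGP q ≡ 1 → φ p ≈M φ q → p ~P q)
    -- surjective onto classes
    × ((M : SqMat) → InK n M →
        Σ (GenPartition n) (λ p → (gcdGP p ≡ 1) × (φ p ≈M M)))
lemma4p3 n _ = (λ p _ → φ-InK p) , (λ p q _ _ → φ-cong p q) , φ-injective , φ-surjective n
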